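{- Let $n=2^k$ with $k>1$ and let $X_n$ be the unitary Cayley graph on $\mathbb{Z}_n$. Then $X_n$ has diameter $2$, its distance spectrum is $\{\frac{3n}{2}-2,\ \frac{n}{2}-2,\ -2,\dots,-2\}$ (with $-2$ of multiplicity $n-2$), and its distance energy is $DE(X_n)=4(n-2)$.
   Context: The unitary Cayley graph $X_n$ has vertex set $\mathbb{Z}_n=\{0,\dots,n-1\}$, with distinct $a,b$ adjacent iff $\gcd(a-b,n)=1$. The distance spectrum is the multiset of eigenvalues of the distance matrix $[d(i,j)]$, and the distance energy $DE$ is the sum of the absolute values of these eigenvalues. -}

module Defs where

open import Data.Nat as ℕ using (ℕ; zero; suc; _≤_; _^_; _∸_)
open import Data.Nat.GCD using (gcd)
open import Data.Integer as ℤ using (ℤ; +_; -_; _-_; _*_; _+_; ∣_∣)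
open import Data.Fin using (Fin; toℕ; punchIn; _≟_) renaming (zero to fzero; suc to fsuc)
open import Data.List using (List; _∷_; []; map; replicate; foldr)
open import Data.Product using (Σ; _×_; ∃; ∃-syntax)
open import Data.Bool using (if_then_else_)
open import Relation.Nullary using (¬_; does)
open import Relation.Binary.PropositionalEquality using (_≡_; _≢_)

-- Unitary Cayley graph X_n on Z_n = Fin n : distinct a, b adjacent iff gcd(a-b, n) = 1.
Adj : (n : ℕ) → Fin n → Fin n → Set
Adj n a b = (a ≢ b) × (gcd (ℕ.∣_-_∣ (toℕ a) (toℕ b)) n ≡ 1)

data Walk (n : ℕ) : Fin n → Fin n → ℕ → Set where
  here : ∀ {a} → Walk n a a 0
  step : ∀ {a b c m} → Adj n a b → Walk n b c m → Walk n a c (suc m)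

IsDist : (n : ℕ) → Fin n → Fin n → ℕ → Set
IsDist n a b m = Walk n a b m × (∀ j → Walk n a b j → m ≤ j)

HasDiameter : (n : ℕ) → ℕ → Set
HasDiameter n d =
  (∀ a b → Σ ℕ (λ m → (m ≤ d) × IsDist n a b m)) × (∃[ a ] ∃[ b ] IsDist n a b d)

sumFin : (n : ℕ) → (Fin n → ℤ) → ℤ
sumFin zero    f = + 0
sumFin (suc n) f = f fzero + sumFin n (λ i → f (fsuc i))

sign : ℕ → ℤ
sign zero = + 1
sign (suc zero) = - (+ 1)
sign (suc (suc k)) = sign k

det : (n : ℕ) → (Fin n → Fin n → ℤ) → ℤ
det zero    M = + 1
det (suc n) M =
  sumFin (suc n) (λ j → sign (toℕ j) * M fzero j * det n (λ r c → M (fsuc r) (punchIn j c)))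

charPoly : (n : ℕ) → (Fin n → Fin n → ℕ) → ℤ → ℤ
charPoly n D x = det n (λ i j → (if does (i ≟ j) then x else + 0) - + (D i j))

prodℤ : List ℤ → ℤ
prodℤ = foldr _*_ (+ 1)

-- L is the spectrum (multiset of eigenvalues, with multiplicity) of D:
-- χ_D(x) = ∏_{λ ∈ L} (x - λ) as polynomials (equality at every integer x).
HasSpectrum : (n : ℕ) → (Fin n → Fin n → ℕ) → List ℤ → Set
HasSpectrum n D L = ∀ (x : ℤ) → charPoly n D x ≡ prodℤ (map (λ μ → x - μ) L)

energy : List ℤ → ℕ
energy L = foldr ℕ._+_ 0 (map ∣_∣ L)

-- For n = 2^k, gcd(d, n) = 1 exactly when d is odd, so X_n is the complete bipartite graph between
-- the even and the odd residues: distinct vertices are at distance 1 across the two classes and 2 within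
-- a class.  Hence xI − D = (x+2)I + W with W constant on the four parity blocks (−2 on the diagonal
-- blocks, −1 off them).  Subtracting from each row i ≥ 2 the row 0 or 1 of the same parity, factoring
-- out x + 2 and clearing rows 0 and 1 leaves (x+2)^(n−2) times the determinant of the 2×2 quotient
-- matrix [[a − n, −n/2], [−n/2, a − n]] (a = x + 2), which is (x − (3n/2 − 2))(x − (n/2 − 2)).
-- An integer polynomial in factored form determines its roots with multiplicity, since two such
-- polynomials agreeing away from a point x agree at x (P(x + N) ≡ P(x) mod N for every N); so every
-- spectrum of D has the same energy 4(n − 2).

module Submission where

open import Defs
open import Data.Nat as ℕ using (ℕ; zero; suc; _≤_; _<_; z≤n; s≤s; _^_; _∸_; parity; ⌊_/2⌋; ⌈_/2⌉)
import Data.Nat.Properties as ℕP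
open import Data.Nat.Divisibility using (_∣_; divides; ∣-trans; ∣1⇒≡1; 0∣⇒≡0; ∣⇒≤; >⇒∤)
open import Data.Nat.GCD using (gcd; gcd-greatest)
open import Data.Nat.Coprimality using (Coprime; coprime-divisor; coprime⇒gcd≡1)
open import Data.Nat.ListAction.Properties using (sum-↭)
import Data.Nat.Tactic.RingSolver as ℕ-Solver
open import Data.Integer as ℤ using (ℤ; +_; -_; _-_; _+_; _*_; ≢-nonZero)
import Data.Integer.Properties as ℤP
open import Data.Integer.Tactic.RingSolver using (solve-∀)
open import Data.Parity.Base as ℙ using (Parity; 0ℙ; 1ℙ; _⁻¹)
import Data.Parity.Properties as ℙP
open import Data.Fin using (Fin; toℕ; fromℕ<; punchIn; _≟_) renaming (zero to fzero; suc to fsuc)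
open import Data.Fin.Properties using (toℕ-fromℕ<)
open import Data.List using (List; []; _∷_; map; replicate)
open import Data.List.Membership.Propositional using (_∈_)
open import Data.List.Relation.Unary.Any using (here; there)
open import Data.List.Relation.Binary.Permutation.Propositional using (_↭_; prep; swap; ↭-refl; ↭-trans; ↭⇒↭ₛ)
open import Data.List.Relation.Binary.Permutation.Propositional.Properties using (map⁺)
open import Data.List.Relation.Binary.Permutation.Setoid.Properties using (foldr-commMonoid)
open import Data.Bool using (true; false; if_then_else_)
open import Data.Product using (∃; _×_; _,_; proj₁; proj₂)
open import Data.Sum using (inj₁; inj₂)
open import Function using (_∘_)
open import Relation.Nullary using (does; yes; no; contradiction)
open import Relation.Nullary.Decidable using (dec-true; dec-false)
open import Relation.Binary.PropositionalEquality
open ≡-Reasoning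

-- Finite sums and Laplace expansion

sumFin-cong : ∀ {m} {f g : Fin m → ℤ} → (∀ i → f i ≡ g i) → sumFin m f ≡ sumFin m g
sumFin-cong {zero}  f≗g = refl
sumFin-cong {suc m} f≗g = cong₂ _+_ (f≗g fzero) (sumFin-cong (λ i → f≗g (fsuc i)))

sumFin-distrib-+ : ∀ {m} (f g : Fin m → ℤ) → sumFin m (λ i → f i + g i) ≡ sumFin m f + sumFin m g
sumFin-distrib-+ {zero}  f g = refl
sumFin-distrib-+ {suc m} f g = begin
  f fzero + g fzero + sumFin m (λ i → f (fsuc i) + g (fsuc i))
    ≡⟨ cong (λ s → f fzero + g fzero + s) (sumFin-distrib-+ (λ i → f (fsuc i)) (λ i → g (fsuc i))) ⟩
  f fzero + g fzero + (sumFin m (λ i → f (fsuc i)) + sumFin m (λ i → g (fsuc i)))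
    ≡⟨ interchange (f fzero) (g fzero) _ _ ⟩
  f fzero + sumFin m (λ i → f (fsuc i)) + (g fzero + sumFin m (λ i → g (fsuc i))) ∎
  where
  interchange : ∀ a b c d → a + b + (c + d) ≡ a + c + (b + d)
  interchange = solve-∀

*-distribˡ-sumFin : ∀ {m} t (f : Fin m → ℤ) → t * sumFin m f ≡ sumFin m (λ i → t * f i)
*-distribˡ-sumFin {zero}  t f = ℤP.*-zeroʳ t
*-distribˡ-sumFin {suc m} t f =
  trans (ℤP.*-distribˡ-+ t (f fzero) _) (cong (_+_ (t * f fzero)) (*-distribˡ-sumFin t (λ i → f (fsuc i))))

neg-distrib-sumFin : ∀ {m} (f : Fin m → ℤ) → - sumFin m f ≡ sumFin m (λ i → - f i)
neg-distrib-sumFin {zero}  f = refl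
neg-distrib-sumFin {suc m} f =
  trans (ℤP.neg-distrib-+ (f fzero) _) (cong (_+_ (- f fzero)) (neg-distrib-sumFin (λ i → f (fsuc i))))

sumFin-zero : ∀ {m} (f : Fin m → ℤ) → (∀ i → f i ≡ + 0) → sumFin m f ≡ + 0
sumFin-zero {m} f f≗0 = trans (sumFin-cong f≗0) (zeros m)
  where
  zeros : ∀ m → sumFin m (λ _ → + 0) ≡ + 0
  zeros zero    = refl
  zeros (suc m) = trans (ℤP.+-identityˡ _) (zeros m)

sign-suc : ∀ n → sign (suc n) ≡ - sign n
sign-suc zero          = refl
sign-suc (suc zero)    = refl
sign-suc (suc (suc n)) = sign-suc n

Matrix : ℕ → Set
Matrix m = Fin m → Fin m → ℤ

minor : ∀ {m} → Fin (suc m) → Matrix (suc m) → Matrix m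
minor j M r c = M (fsuc r) (punchIn j c)

setRow : ∀ {m} → Matrix m → Fin m → (Fin m → ℤ) → Matrix m
setRow M i v r c = if does (r ≟ i) then v c else M r c

setRow-≡ : ∀ {m} (M : Matrix m) i v c → setRow M i v i c ≡ v c
setRow-≡ M i v c = cong (if_then v c else M i c) (dec-true (i ≟ i) refl)

setRow-≢ : ∀ {m} (M : Matrix m) {i r} v c → r ≢ i → setRow M i v r c ≡ M r c
setRow-≢ M {i} {r} v c r≢i = cong (if_then v c else M r c) (dec-false (r ≟ i) r≢i)

det-cong : ∀ {m} {M N : Matrix m} → (∀ r c → M r c ≡ N r c) → det m M ≡ det m N
det-cong {zero}  M≗N = refl
det-cong {suc m} M≗N = sumFin-cong λ j →
  cong₂ (λ a d → sign (toℕ j) * a * d) (M≗N fzero j) (det-cong (λ r c → M≗N (fsuc r) (punchIn j c)))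

det-setRow-cong : ∀ {m} (M : Matrix m) i {v v′ : Fin m → ℤ} → (∀ c → v c ≡ v′ c) →
  det m (setRow M i v) ≡ det m (setRow M i v′)
det-setRow-cong M i v≗v′ = det-cong λ r c → cong (λ x → if does (r ≟ i) then x else M r c) (v≗v′ c)

det-setRow-+ : ∀ {m} (M : Matrix m) i (u v : Fin m → ℤ) →
  det m (setRow M i (λ c → u c + v c)) ≡ det m (setRow M i u) + det m (setRow M i v)
det-setRow-+ {suc m} M fzero u v =
  trans (sumFin-cong (λ j → distrib (sign (toℕ j)) (u j) (v j) (det m (minor j M))))
        (sumFin-distrib-+ (λ j → sign (toℕ j) * u j * det m (minor j M))
                          (λ j → sign (toℕ j) * v j * det m (minor j M)))
  where
  distrib : ∀ s a b d → s * (a + b) * d ≡ s * a * d + s * b * d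
  distrib = solve-∀
det-setRow-+ {suc m} M (fsuc i) u v =
  trans (sumFin-cong λ j → trans (cong (_*_ (a j)) (det-setRow-+ (minor j M) i (u ∘ punchIn j) (v ∘ punchIn j)))
                                 (ℤP.*-distribˡ-+ (a j) (dᵤ j) (dᵥ j)))
        (sumFin-distrib-+ (λ j → a j * dᵤ j) (λ j → a j * dᵥ j))
  where
  a : Fin (suc m) → ℤ
  a j = sign (toℕ j) * M fzero j
  dᵤ dᵥ : Fin (suc m) → ℤ
  dᵤ j = det m (setRow (minor j M) i (u ∘ punchIn j))
  dᵥ j = det m (setRow (minor j M) i (v ∘ punchIn j))

det-setRow-* : ∀ {m} (M : Matrix m) i t (v : Fin m → ℤ) →
  det m (setRow M i (λ c → t * v c)) ≡ t * det m (setRow M i v)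
det-setRow-* {suc m} M fzero t v =
  trans (sumFin-cong (λ j → pull (sign (toℕ j)) t (v j) (det m (minor j M))))
        (sym (*-distribˡ-sumFin t (λ j → sign (toℕ j) * v j * det m (minor j M))))
  where
  pull : ∀ s t a d → s * (t * a) * d ≡ t * (s * a * d)
  pull = solve-∀
det-setRow-* {suc m} M (fsuc i) t v =
  trans (sumFin-cong λ j → trans (cong (_*_ (a j)) (det-setRow-* (minor j M) i t (v ∘ punchIn j)))
                                 (pull (a j) t (d j)))
        (sym (*-distribˡ-sumFin t (λ j → a j * d j)))
  where
  a d : Fin (suc m) → ℤ
  a j = sign (toℕ j) * M fzero j
  d j = det m (setRow (minor j M) i (v ∘ punchIn j))
  pull : ∀ a t d → a * (t * d) ≡ t * (a * d)
  pull = solve-∀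

-- det (p + 2) M is definitionally doubleLaplace p (M 0) (M 1) D, where D e is the determinant of
-- rows 2, 3, … restricted to the columns listed by e.
doubleLaplace : ∀ p (u v : Fin (suc (suc p)) → ℤ) → ((Fin p → Fin (suc (suc p))) → ℤ) → ℤ
doubleLaplace p u v D = sumFin (suc (suc p)) λ j → sign (toℕ j) * u j *
  sumFin (suc p) (λ l → sign (toℕ l) * v (punchIn j l) * D (λ c → punchIn j (punchIn l c)))

ColumnExtensional : ∀ {p q} → ((Fin p → Fin q) → ℤ) → Set
ColumnExtensional D = ∀ {e e′} → (∀ c → e c ≡ e′ c) → D e ≡ D e′

liftColumns : ∀ {p q} → (Fin p → Fin q) → Fin (suc p) → Fin (suc q)
liftColumns e fzero    = fzero
liftColumns e (fsuc c) = fsuc (e c)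

-- The terms of the double expansion in which row 0 or row 1 uses column 0 cancel in pairs.
doubleLaplace-peel : ∀ p u D → doubleLaplace p u u D ≡
  sumFin (suc p) λ j → sign (toℕ j) * u (fsuc j) *
    sumFin p (λ l → sign (toℕ l) * u (fsuc (punchIn j l)) * D (λ c → punchIn (fsuc j) (punchIn (fsuc l) c)))
doubleLaplace-peel p u D = begin
  + 1 * u fzero * sumFin (suc p) (λ l → sign (toℕ l) * u (fsuc l) * Dₗ l) + sumFin (suc p) outer
    ≡⟨ cong₂ _+_ (trans (*-distribˡ-sumFin (+ 1 * u fzero) (λ l → sign (toℕ l) * u (fsuc l) * Dₗ l)) (sumFin-cong first))
                 (sumFin-cong split) ⟩
  sumFin (suc p) b + sumFin (suc p) (λ j → - b j + r j)
    ≡⟨ cong (_+_ (sumFin (suc p) b)) (trans (sumFin-distrib-+ (λ j → - b j) r)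
                                           (cong (_+ sumFin (suc p) r) (sym (neg-distrib-sumFin b)))) ⟩
  sumFin (suc p) b + (- sumFin (suc p) b + sumFin (suc p) r)
    ≡⟨ cancel (sumFin (suc p) b) _ ⟩
  sumFin (suc p) r ∎
  where
  Dₗ : Fin (suc p) → ℤ
  Dₗ l = D (λ c → fsuc (punchIn l c))
  Dʲ inner : Fin (suc p) → Fin p → ℤ
  Dʲ j l = D (λ c → punchIn (fsuc j) (punchIn (fsuc l) c))
  inner j l = sign (toℕ l) * u (fsuc (punchIn j l)) * Dʲ j l
  outer b r : Fin (suc p) → ℤ
  outer j = sign (toℕ (fsuc j)) * u (fsuc j) *
    (+ 1 * u fzero * Dₗ j + sumFin p (λ l → sign (toℕ (fsuc l)) * u (fsuc (punchIn j l)) * Dʲ j l))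
  b j = sign (toℕ j) * u (fsuc j) * u fzero * Dₗ j
  r j = sign (toℕ j) * u (fsuc j) * sumFin p (inner j)
  first : ∀ l → + 1 * u fzero * (sign (toℕ l) * u (fsuc l) * Dₗ l) ≡ b l
  first l = lemma (sign (toℕ l)) (u fzero) (u (fsuc l)) (Dₗ l)
    where lemma : ∀ s a x d → + 1 * a * (s * x * d) ≡ s * x * a * d
          lemma = solve-∀
  negated-inner : ∀ j → sumFin p (λ l → sign (toℕ (fsuc l)) * u (fsuc (punchIn j l)) * Dʲ j l) ≡ - sumFin p (inner j)
  negated-inner j =
    trans (sumFin-cong λ l → trans (cong (λ s → s * u (fsuc (punchIn j l)) * Dʲ j l) (sign-suc (toℕ l)))
                                   (pull (sign (toℕ l)) (u (fsuc (punchIn j l))) (Dʲ j l)))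
          (sym (neg-distrib-sumFin (inner j)))
    where pull : ∀ s x d → - s * x * d ≡ - (s * x * d)
          pull = solve-∀
  split : ∀ j → outer j ≡ - b j + r j
  split j = trans (cong₂ (λ s S → s * u (fsuc j) * (+ 1 * u fzero * Dₗ j + S)) (sign-suc (toℕ j)) (negated-inner j))
                  (lemma (sign (toℕ j)) (u (fsuc j)) (u fzero) (Dₗ j) (sumFin p (inner j)))
    where lemma : ∀ s x a d S → - s * x * (+ 1 * a * d + - S) ≡ - (s * x * a * d) + s * x * S
          lemma = solve-∀
  cancel : ∀ x y → x + (- x + y) ≡ y
  cancel = solve-∀

doubleLaplace-diagonal : ∀ p u D → ColumnExtensional D → doubleLaplace p u u D ≡ + 0
doubleLaplace-diagonal zero    u D _   =
  trans (doubleLaplace-peel 0 u D) (sumFin-zero _ λ j → ℤP.*-zeroʳ (sign (toℕ j) * u (fsuc j)))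
doubleLaplace-diagonal (suc q) u D ext =
  trans (doubleLaplace-peel (suc q) u D)
   (trans (sumFin-cong {g = λ j → sign (toℕ j) * u (fsuc j) * sumFin (suc q) (lifted j)} λ j →
            cong (_*_ (sign (toℕ j) * u (fsuc j))) (sumFin-cong {g = lifted j} λ l →
            cong (_*_ (sign (toℕ l) * u (fsuc (punchIn j l)))) (lift-interior j l)))
          (doubleLaplace-diagonal q (u ∘ fsuc) (D ∘ liftColumns)
            (λ e≗e′ → ext λ { fzero → refl ; (fsuc c) → cong fsuc (e≗e′ c) })))
  where
  lifted : Fin (suc (suc q)) → Fin (suc q) → ℤ
  lifted j l = sign (toℕ l) * u (fsuc (punchIn j l)) * D (liftColumns (λ c → punchIn j (punchIn l c)))
  lift-interior : ∀ j l → D (λ c → punchIn (fsuc j) (punchIn (fsuc l) c)) ≡ D (liftColumns (λ c → punchIn j (punchIn l c)))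
  lift-interior j l = ext λ { fzero → refl ; (fsuc c) → refl }

det-equal-rows01 : ∀ {p} (M : Matrix (suc (suc p))) → (∀ c → M fzero c ≡ M (fsuc fzero) c) → det (suc (suc p)) M ≡ + 0
det-equal-rows01 {p} M eq = trans (det-cong copy) (doubleLaplace-diagonal p (M fzero) D ext)
  where
  D : (Fin p → Fin (suc (suc p))) → ℤ
  D e = det p (λ r c → M (fsuc (fsuc r)) (e c))
  ext : ColumnExtensional D
  ext e≗e′ = det-cong (λ r c → cong (M (fsuc (fsuc r))) (e≗e′ c))
  copy : ∀ r c → M r c ≡ setRow M (fsuc fzero) (M fzero) r c
  copy fzero           c = refl
  copy (fsuc fzero)    c = sym (eq c)
  copy (fsuc (fsuc r)) c = refl

swapRows : ∀ {m} → Fin m → Fin m → Matrix m → Matrix m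
swapRows i j M = setRow (setRow M i (M j)) j (M i)

mutual
  det-equal-rows : ∀ {m} (M : Matrix m) {i j} → i ≢ j → (∀ c → M i c ≡ M j c) → det m M ≡ + 0
  det-equal-rows {suc m} M {fzero}  {fzero}  i≢j eq = contradiction refl i≢j
  det-equal-rows {suc m} M {fzero}  {fsuc j} i≢j eq = det-equal-row0 M j eq
  det-equal-rows {suc m} M {fsuc i} {fzero}  i≢j eq = det-equal-row0 M i (sym ∘ eq)
  det-equal-rows {suc m} M {fsuc i} {fsuc j} i≢j eq =
    sumFin-zero (λ k → sign (toℕ k) * M fzero k * det m (minor k M)) λ k →
      trans (cong (_*_ (sign (toℕ k) * M fzero k)) (det-equal-rows (minor k M) (i≢j ∘ cong fsuc) (eq ∘ punchIn k)))
            (ℤP.*-zeroʳ (sign (toℕ k) * M fzero k))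

  det-equal-row0 : ∀ {m} (M : Matrix (suc m)) (j : Fin m) → (∀ c → M fzero c ≡ M (fsuc j) c) → det (suc m) M ≡ + 0
  det-equal-row0 M fzero    eq = det-equal-rows01 M eq
  det-equal-row0 {m} M (fsuc j) eq = begin
    det (suc m) M           ≡⟨ ℤP.neg-involutive (det (suc m) M) ⟨
    - - det (suc m) M       ≡⟨ cong -_ (det-swapRows-suc M {fzero} {fsuc j} (λ ())) ⟨
    - det (suc m) M′        ≡⟨ cong -_ (det-equal-rows01 M′ eq) ⟩
    + 0                     ∎
    where
    M′ : Matrix (suc m)
    M′ = swapRows (fsuc fzero) (fsuc (fsuc j)) M

  det-swapRows-suc : ∀ {m} (M : Matrix (suc m)) {a b} → a ≢ b →
    det (suc m) (swapRows (fsuc a) (fsuc b) M) ≡ - det (suc m) M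
  det-swapRows-suc {m} M a≢b =
    trans (sumFin-cong λ j → trans (cong (_*_ (sign (toℕ j) * M fzero j)) (det-swapRows (minor j M) a≢b))
                                   (sym (ℤP.neg-distribʳ-* (sign (toℕ j) * M fzero j) (det m (minor j M)))))
          (sym (neg-distrib-sumFin (λ j → sign (toℕ j) * M fzero j * det m (minor j M))))

  -- Expand 0 = det S(v+w, v+w) by linearity in rows i and j.
  det-swapRows : ∀ {m} (M : Matrix m) {i j} → i ≢ j → det m (swapRows i j M) ≡ - det m M
  det-swapRows {m} M {i} {j} i≢j = begin
    det m (S w v)                                                     ≡⟨ solve-swap _ _ expanded ⟩
    - det m (S v w)                                                   ≡⟨ cong -_ (det-cong unchanged) ⟩
    - det m M                                                         ∎
    where
    v w : Fin m → ℤ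
    v = M i
    w = M j
    S : (Fin m → ℤ) → (Fin m → ℤ) → Matrix m
    S x y = setRow (setRow M i x) j y
    S-i : ∀ x y c → S x y i c ≡ x c
    S-i x y c = trans (setRow-≢ (setRow M i x) y c i≢j) (setRow-≡ M i x c)
    S-j : ∀ x y c → S x y j c ≡ y c
    S-j x y c = setRow-≡ (setRow M i x) j y c
    S-comm : ∀ x y r c → S x y r c ≡ setRow (setRow M j y) i x r c
    S-comm x y r c with r ≟ i | r ≟ j
    ... | yes refl | yes refl = contradiction refl i≢j
    ... | yes _    | no _     = refl
    ... | no _     | yes _    = refl
    ... | no _     | no _     = refl
    unchanged : ∀ r c → S v w r c ≡ M r c
    unchanged r c with r ≟ i | r ≟ j
    ... | yes refl | yes i≡j  = contradiction i≡j i≢j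
    ... | yes refl | no _     = refl
    ... | no _     | yes refl = refl
    ... | no _     | no _     = refl
    vanishes : ∀ x → det m (S x x) ≡ + 0
    vanishes x = det-equal-rows (S x x) i≢j (λ c → trans (S-i x x c) (sym (S-j x x c)))
    linearˡ : ∀ x x′ y → det m (S (λ c → x c + x′ c) y) ≡ det m (S x y) + det m (S x′ y)
    linearˡ x x′ y = trans (det-cong (S-comm _ y))
      (trans (det-setRow-+ (setRow M j y) i x x′)
             (sym (cong₂ _+_ (det-cong (S-comm x y)) (det-cong (S-comm x′ y)))))
    expanded : + 0 ≡ (+ 0 + det m (S v w)) + (det m (S w v) + + 0)
    expanded = begin
      + 0                                                                 ≡⟨ vanishes (λ c → v c + w c) ⟨
      det m (S (λ c → v c + w c) (λ c → v c + w c))                       ≡⟨ linearˡ v w _ ⟩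
      det m (S v (λ c → v c + w c)) + det m (S w (λ c → v c + w c))
        ≡⟨ cong₂ _+_ (det-setRow-+ (setRow M i v) j v w) (det-setRow-+ (setRow M i w) j v w) ⟩
      (det m (S v v) + det m (S v w)) + (det m (S w v) + det m (S w w))
        ≡⟨ cong₂ (λ a b → (a + det m (S v w)) + (det m (S w v) + b)) (vanishes v) (vanishes w) ⟩
      (+ 0 + det m (S v w)) + (det m (S w v) + + 0)                       ∎
    solve-swap : ∀ a b → + 0 ≡ (+ 0 + a) + (b + + 0) → b ≡ - a
    solve-swap a b e = trans (sym (lemma a b)) (trans (cong (_- a) (sym e)) (ℤP.+-identityˡ (- a)))
      where lemma : ∀ a b → (+ 0 + a) + (b + + 0) - a ≡ b
            lemma = solve-∀

det-setRow-self : ∀ {m} (M : Matrix m) i → det m (setRow M i (M i)) ≡ det m M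
det-setRow-self M i = det-cong λ r c → self r c
  where
  self : ∀ r c → setRow M i (M i) r c ≡ M r c
  self r c with r ≟ i
  ... | yes refl = refl
  ... | no _     = refl

det-setRow-copy : ∀ {m} (M : Matrix m) {i k} → i ≢ k → det m (setRow M i (M k)) ≡ + 0
det-setRow-copy M {i} {k} i≢k =
  det-equal-rows (setRow M i (M k)) i≢k (λ c → trans (setRow-≡ M i (M k) c) (sym (setRow-≢ M (M k) c (i≢k ∘ sym))))

det-setRow-add : ∀ {m} (M : Matrix m) {i k} t → i ≢ k → det m (setRow M i (λ c → M i c + t * M k c)) ≡ det m M
det-setRow-add {m} M {i} {k} t i≢k = begin
  det m (setRow M i (λ c → M i c + t * M k c))                     ≡⟨ det-setRow-+ M i (M i) (λ c → t * M k c) ⟩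
  det m (setRow M i (M i)) + det m (setRow M i (λ c → t * M k c))
    ≡⟨ cong₂ _+_ (det-setRow-self M i) (det-setRow-* M i t (M k)) ⟩
  det m M + t * det m (setRow M i (M k))                           ≡⟨ cong (λ d → det m M + t * d) (det-setRow-copy M i≢k) ⟩
  det m M + t * + 0                                                ≡⟨ cong (_+_ (det m M)) (ℤP.*-zeroʳ t) ⟩
  det m M + + 0                                                    ≡⟨ ℤP.+-identityʳ (det m M) ⟩
  det m M                                                          ∎

det-setRow-sum : ∀ {m} (M : Matrix m) i {s} (V : Fin s → Fin m → ℤ) →
  det m (setRow M i (λ c → sumFin s (λ k → V k c))) ≡ sumFin s (λ k → det m (setRow M i (V k)))
det-setRow-sum {m} M i {zero} V = begin
  det m (setRow M i (λ _ → + 0))          ≡⟨ det-setRow-* M i (+ 0) (M i) ⟩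
  + 0 * det m (setRow M i (M i))          ≡⟨⟩
  + 0                                     ∎
det-setRow-sum {m} M i {suc s} V =
  trans (det-setRow-+ M i (V fzero) (λ c → sumFin s (λ k → V (fsuc k) c)))
        (cong (_+_ (det m (setRow M i (V fzero)))) (det-setRow-sum M i (V ∘ fsuc)))

det-setRow-comb : ∀ {m} (M : Matrix m) i (g : Fin m → ℤ) → g i ≡ + 0 →
  det m (setRow M i (λ c → M i c + sumFin m (λ k → g k * M k c))) ≡ det m M
det-setRow-comb {m} M i g gᵢ≡0 = begin
  det m (setRow M i (λ c → M i c + sumFin m (λ k → g k * M k c)))
    ≡⟨ det-setRow-+ M i (M i) (λ c → sumFin m (λ k → g k * M k c)) ⟩
  det m (setRow M i (M i)) + det m (setRow M i (λ c → sumFin m (λ k → g k * M k c)))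
    ≡⟨ cong₂ _+_ (det-setRow-self M i) (det-setRow-sum M i (λ k c → g k * M k c)) ⟩
  det m M + sumFin m (λ k → det m (setRow M i (λ c → g k * M k c)))
    ≡⟨ cong (_+_ (det m M)) (sumFin-zero _ vanishes) ⟩
  det m M + + 0
    ≡⟨ ℤP.+-identityʳ (det m M) ⟩
  det m M ∎
  where
  vanishes : ∀ k → det m (setRow M i (λ c → g k * M k c)) ≡ + 0
  vanishes k with det-setRow-* M i (g k) (M k) | k ≟ i
  ... | scaled | yes refl = trans scaled (cong (_* det m (setRow M i (M i))) gᵢ≡0)
  ... | scaled | no k≢i   = trans scaled (trans (cong (_*_ (g k)) (det-setRow-copy M (k≢i ∘ sym))) (ℤP.*-zeroʳ (g k)))

-- The minors forget row 0, so a source row 0 is first swapped to row 1.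
mutual
  det-add-multiples : ∀ {m} (M : Matrix m) k (g : Fin m → ℤ) → g k ≡ + 0 →
    det m (λ r c → M r c + g r * M k c) ≡ det m M
  det-add-multiples {suc m}       M (fsuc k) g gₖ≡0 = det-add-multiples-suc M k g gₖ≡0
  det-add-multiples {suc zero}    M fzero    g g₀≡0 =
    det-cong {M = λ r c → M r c + g r * M fzero c} {N = M} λ { fzero c →
      trans (cong (λ t → M fzero c + t * M fzero c) g₀≡0) (ℤP.+-identityʳ (M fzero c)) }
  det-add-multiples {suc (suc m)} M fzero    g g₀≡0 = begin
    det _ N                   ≡⟨ ℤP.neg-involutive (det _ N) ⟨
    - - det _ N               ≡⟨ cong -_ (det-swapRows N {fzero} {fsuc fzero} (λ ())) ⟨
    - det _ (swapRows fzero (fsuc fzero) N)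
      ≡⟨ cong -_ (trans (det-cong swapped) (det-add-multiples-suc (swapRows fzero (fsuc fzero) M) fzero g′ g₀≡0)) ⟩
    - det _ (swapRows fzero (fsuc fzero) M)
      ≡⟨ cong -_ (det-swapRows M {fzero} {fsuc fzero} (λ ())) ⟩
    - - det _ M               ≡⟨ ℤP.neg-involutive (det _ M) ⟩
    det _ M                   ∎
    where
    N : Matrix (suc (suc m))
    N r c = M r c + g r * M fzero c
    g′ : Fin (suc (suc m)) → ℤ
    g′ fzero           = g (fsuc fzero)
    g′ (fsuc fzero)    = g fzero
    g′ (fsuc (fsuc r)) = g (fsuc (fsuc r))
    swapped : ∀ r c → swapRows fzero (fsuc fzero) N r c ≡
      swapRows fzero (fsuc fzero) M r c + g′ r * swapRows fzero (fsuc fzero) M (fsuc fzero) c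
    swapped fzero           c = refl
    swapped (fsuc fzero)    c = refl
    swapped (fsuc (fsuc r)) c = refl

  det-add-multiples-suc : ∀ {m} (M : Matrix (suc m)) k (g : Fin (suc m) → ℤ) → g (fsuc k) ≡ + 0 →
    det (suc m) (λ r c → M r c + g r * M (fsuc k) c) ≡ det (suc m) M
  det-add-multiples-suc {m} M k g gₖ≡0 =
    trans (sumFin-cong λ j → cong (_*_ (sign (toℕ j) * (M fzero j + g fzero * M (fsuc k) j)))
                                  (det-add-multiples (minor j M) k (g ∘ fsuc) gₖ≡0))
          (det-setRow-add M {fzero} {fsuc k} (g fzero) (λ ()))

prodFin : ∀ m → (Fin m → ℤ) → ℤ
prodFin zero    h = + 1
prodFin (suc m) h = h fzero * prodFin m (h ∘ fsuc)

det-scale-rows : ∀ {m} (M : Matrix m) (h : Fin m → ℤ) → det m (λ r c → h r * M r c) ≡ prodFin m h * det m M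
det-scale-rows {zero}  M h = refl
det-scale-rows {suc m} M h =
  trans (sumFin-cong λ j → trans (cong (_*_ (sign (toℕ j) * (h fzero * M fzero j))) (det-scale-rows (minor j M) (h ∘ fsuc)))
                                 (regroup (sign (toℕ j)) (h fzero) (M fzero j) (prodFin m (h ∘ fsuc)) (det m (minor j M))))
        (sym (*-distribˡ-sumFin (prodFin (suc m) h) (λ j → sign (toℕ j) * M fzero j * det m (minor j M))))
  where
  regroup : ∀ s a x p d → s * (a * x) * (p * d) ≡ a * p * (s * x * d)
  regroup = solve-∀

det-unit-row0 : ∀ {m} (M : Matrix (suc m)) → (∀ j → M fzero (fsuc j) ≡ + 0) →
  det (suc m) M ≡ M fzero fzero * det m (minor fzero M)
det-unit-row0 {m} M row0 =
  trans (cong₂ _+_ (cong (_* det m (minor fzero M)) (ℤP.*-identityˡ (M fzero fzero)))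
                   (sumFin-zero _ λ j → trans (cong (λ x → sign (toℕ (fsuc j)) * x * det m (minor (fsuc j) M)) (row0 j))
                                              (cong (_* det m (minor (fsuc j) M)) (ℤP.*-zeroʳ (sign (toℕ (fsuc j)))))))
        (ℤP.+-identityʳ _)

identity : ∀ {m} → Matrix m
identity i j = if does (i ≟ j) then + 1 else + 0

det-identity : ∀ m → det m identity ≡ + 1
det-identity zero    = refl
det-identity (suc m) = trans (det-unit-row0 {m} identity (λ _ → refl)) (trans (ℤP.*-identityˡ (det m identity)) (det-identity m))

sumFin-identity : ∀ {m} (f : Fin m → ℤ) s → sumFin m (λ t → f t * identity t s) ≡ f s
sumFin-identity {suc m} f fzero =
  trans (cong₂ _+_ (ℤP.*-identityʳ (f fzero)) (sumFin-zero _ λ t → ℤP.*-zeroʳ (f (fsuc t)))) (ℤP.+-identityʳ (f fzero))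
sumFin-identity {suc m} f (fsuc s) =
  trans (cong₂ _+_ (ℤP.*-zeroʳ (f fzero)) (sumFin-identity (f ∘ fsuc) s)) (ℤP.+-identityˡ (f (fsuc s)))

-- Matrices constant on parity blocks

parityOf : ∀ {n} → Fin n → Parity
parityOf i = parity (toℕ i)

sumFin-parity : ∀ m (F : Parity → ℤ) → sumFin m (F ∘ parityOf) ≡ + ⌈ m /2⌉ * F 0ℙ + + ⌊ m /2⌋ * F 1ℙ
sumFin-parity zero          F = refl
sumFin-parity (suc zero)    F = trans (ℤP.+-identityʳ (F 0ℙ)) (sym (trans (ℤP.+-identityʳ _) (ℤP.*-identityˡ (F 0ℙ))))
sumFin-parity (suc (suc m)) F = begin
  F 0ℙ + (F 1ℙ + sumFin m (F ∘ parityOf))                  ≡⟨ cong (λ s → F 0ℙ + (F 1ℙ + s)) (sumFin-parity m F) ⟩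
  F 0ℙ + (F 1ℙ + (+ e * F 0ℙ + + o * F 1ℙ))                ≡⟨ regroup (+ e) (+ o) (F 0ℙ) (F 1ℙ) ⟩
  (+ 1 + + e) * F 0ℙ + (+ 1 + + o) * F 1ℙ
    ≡⟨ cong₂ (λ x y → x * F 0ℙ + y * F 1ℙ) (ℤP.pos-+ 1 e) (ℤP.pos-+ 1 o) ⟨
  + suc e * F 0ℙ + + suc o * F 1ℙ                          ∎
  where
  e = ⌈ m /2⌉
  o = ⌊ m /2⌋
  regroup : ∀ e o x y → x + (y + (e * x + o * y)) ≡ (+ 1 + e) * x + (+ 1 + o) * y
  regroup = solve-∀

parityMatrix : ∀ {n} → (Parity → Parity → ℤ) → ℤ → Matrix n
parityMatrix w a i j = identity i j * a + w (parityOf i) (parityOf j)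

parityCount : ℕ → Parity → ℕ
parityCount n 0ℙ = ⌈ n /2⌉
parityCount n 1ℙ = ⌊ n /2⌋

δℙ : Parity → Parity → ℤ
δℙ p q = if does (p ℙP.≟ q) then + 1 else + 0

quotientMatrix : (Parity → Parity → ℤ) → ℤ → ℕ → Parity → Parity → ℤ
quotientMatrix w a n p q = δℙ p q * a + + parityCount n q * w p q

det₂ : (Parity → Parity → ℤ) → ℤ
det₂ Q = Q 0ℙ 0ℙ * Q 1ℙ 1ℙ - Q 0ℙ 1ℙ * Q 1ℙ 0ℙ

prodFin-const : ∀ m a → prodFin m (λ _ → a) ≡ a ℤ.^ m
prodFin-const zero    a = refl
prodFin-const (suc m) a = cong (a *_) (prodFin-const m a)

module _ (w : Parity → Parity → ℤ) (a : ℤ) {m : ℕ} where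

  private
    n = suc (suc m)
    P = parityMatrix {n} w a
    Q = quotientMatrix w a n

  baseRow : Parity → Fin n
  baseRow 0ℙ = fzero
  baseRow 1ℙ = fsuc fzero

  identity-baseRow : ∀ p q → identity (baseRow p) (baseRow q) ≡ δℙ p q
  identity-baseRow 0ℙ 0ℙ = refl
  identity-baseRow 0ℙ 1ℙ = refl
  identity-baseRow 1ℙ 0ℙ = refl
  identity-baseRow 1ℙ 1ℙ = refl

  identity-baseRow-suc² : ∀ p s → identity (baseRow p) (fsuc (fsuc s)) ≡ + 0
  identity-baseRow-suc² 0ℙ s = refl
  identity-baseRow-suc² 1ℙ s = refl

  -- Rows 2, 3, … after subtracting row 0 or row 1 of the same parity and dividing by a.
  reduced : Matrix n
  reduced fzero           c = P fzero c
  reduced (fsuc fzero)    c = P (fsuc fzero) c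
  reduced (fsuc (fsuc t)) c = identity (fsuc (fsuc t)) c - identity (baseRow (parityOf t)) c

  rowScale : Fin n → ℤ
  rowScale fzero           = + 1
  rowScale (fsuc fzero)    = + 1
  rowScale (fsuc (fsuc t)) = a

  elimination : Parity → Fin n → ℤ
  elimination p fzero           = + 0
  elimination p (fsuc fzero)    = + 0
  elimination p (fsuc (fsuc t)) = if does (parityOf t ℙP.≟ p) then - + 1 else + 0

  det-parityMatrix-reduce : det n P ≡ a ℤ.^ m * det n reduced
  det-parityMatrix-reduce = begin
    det n P                                        ≡⟨ det-add-multiples P fzero (elimination 0ℙ) refl ⟨
    det n P₁                                       ≡⟨ det-add-multiples P₁ (fsuc fzero) (elimination 1ℙ) refl ⟨
    det n (λ r c → P₁ r c + elimination 1ℙ r * P₁ (fsuc fzero) c)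
                                                   ≡⟨ det-cong eliminated ⟨
    det n (λ r c → rowScale r * reduced r c)       ≡⟨ det-scale-rows reduced rowScale ⟩
    + 1 * (+ 1 * prodFin m (λ _ → a)) * det n reduced
      ≡⟨ cong (_* det n reduced) (trans (ℤP.*-identityˡ _) (trans (ℤP.*-identityˡ _) (prodFin-const m a))) ⟩
    a ℤ.^ m * det n reduced                        ∎
    where
    P₁ : Matrix n
    P₁ r c = P r c + elimination 0ℙ r * P fzero c
    eliminated : ∀ r c → rowScale r * reduced r c ≡ P₁ r c + elimination 1ℙ r * P₁ (fsuc fzero) c
    kept : ∀ x → + 1 * x ≡ x + + 0 + + 0
    kept = solve-∀
    eliminated fzero           c = kept (P fzero c)
    eliminated (fsuc fzero)    c = kept (P (fsuc fzero) c)
    eliminated (fsuc (fsuc t)) c with parityOf t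
    ... | 0ℙ = even a (identity (fsuc (fsuc t)) c) (identity fzero c) (w 0ℙ (parityOf c))
      where even : ∀ a d d₀ x → a * (d - d₀) ≡ d * a + x + - + 1 * (d₀ * a + x) + + 0
            even = solve-∀
    ... | 1ℙ = odd a (identity (fsuc (fsuc t)) c) (identity (fsuc fzero) c) (w 1ℙ (parityOf c))
      where odd : ∀ a d d₁ x → a * (d - d₁) ≡ d * a + x + + 0 + - + 1 * (d₁ * a + x + + 0)
            odd = solve-∀

  clearedRow : Parity → Fin n → ℤ
  clearedRow p fzero           = Q p 0ℙ
  clearedRow p (fsuc fzero)    = Q p 1ℙ
  clearedRow p (fsuc (fsuc _)) = + 0

  clearing : Parity → Fin n → ℤ
  clearing p fzero           = + 0
  clearing p (fsuc fzero)    = + 0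
  clearing p (fsuc (fsuc t)) = - w p (parityOf t)

  clearing-sum-baseRow : ∀ p q → sumFin m (λ t → clearing p (fsuc (fsuc t)) * reduced (fsuc (fsuc t)) (baseRow q)) ≡
                                 + parityCount m q * w p q
  clearing-sum-baseRow p 0ℙ =
    trans (sumFin-parity m (λ r → - w p r * (+ 0 - identity (baseRow r) fzero)))
          (collect (+ ⌈ m /2⌉) (+ ⌊ m /2⌋) (w p 0ℙ) (w p 1ℙ))
    where collect : ∀ e o x y → e * (- x * (+ 0 - + 1)) + o * (- y * (+ 0 - + 0)) ≡ e * x
          collect = solve-∀
  clearing-sum-baseRow p 1ℙ =
    trans (sumFin-parity m (λ r → - w p r * (+ 0 - identity (baseRow r) (fsuc fzero))))
          (collect (+ ⌈ m /2⌉) (+ ⌊ m /2⌋) (w p 0ℙ) (w p 1ℙ))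
    where collect : ∀ e o x y → e * (- x * (+ 0 - + 0)) + o * (- y * (+ 0 - + 1)) ≡ o * y
          collect = solve-∀

  clearing-sum-suc² : ∀ p s → sumFin m (λ t → clearing p (fsuc (fsuc t)) * reduced (fsuc (fsuc t)) (fsuc (fsuc s))) ≡
                              - w p (parityOf s)
  clearing-sum-suc² p s =
    trans (sumFin-cong λ t → cong (λ z → - w p (parityOf t) * (identity t s - z)) (identity-baseRow-suc² (parityOf t) s))
    (trans (sumFin-cong λ t → cong (_*_ (- w p (parityOf t))) (ℤP.+-identityʳ (identity t s)))
           (sumFin-identity (λ t → - w p (parityOf t)) s))

  parityOf-baseRow : ∀ p → parityOf (baseRow p) ≡ p
  parityOf-baseRow 0ℙ = refl
  parityOf-baseRow 1ℙ = refl

  P-baseRow : ∀ p q → P (baseRow p) (baseRow q) ≡ δℙ p q * a + w p q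
  P-baseRow p q = cong₂ (λ d x → d * a + x) (identity-baseRow p q) (cong₂ w (parityOf-baseRow p) (parityOf-baseRow q))

  clearedRow-baseRow : ∀ p q → clearedRow p (baseRow q) ≡ δℙ p q * a + (+ 1 + + parityCount m q) * w p q
  clearedRow-baseRow p 0ℙ = cong (λ k → δℙ p 0ℙ * a + k * w p 0ℙ) (ℤP.pos-+ 1 ⌈ m /2⌉)
  clearedRow-baseRow p 1ℙ = cong (λ k → δℙ p 1ℙ * a + k * w p 1ℙ) (ℤP.pos-+ 1 ⌊ m /2⌋)

  det-clear-row : ∀ p (M : Matrix n) → (∀ t c → M (fsuc (fsuc t)) c ≡ reduced (fsuc (fsuc t)) c) →
    (∀ c → M (baseRow p) c ≡ P (baseRow p) c) → det n (setRow M (baseRow p) (clearedRow p)) ≡ det n M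
  det-clear-row p M lower base =
    trans (det-setRow-cong M (baseRow p) row-cleared) (det-setRow-comb M (baseRow p) (clearing p) (clearing-baseRow p))
    where
    clearing-baseRow : ∀ q → clearing q (baseRow q) ≡ + 0
    clearing-baseRow 0ℙ = refl
    clearing-baseRow 1ℙ = refl
    S : Fin n → ℤ
    S c = sumFin m (λ t → clearing p (fsuc (fsuc t)) * M (fsuc (fsuc t)) c)
    S-reduced : ∀ c → S c ≡ sumFin m (λ t → clearing p (fsuc (fsuc t)) * reduced (fsuc (fsuc t)) c)
    S-reduced c = sumFin-cong λ t → cong (_*_ (clearing p (fsuc (fsuc t)))) (lower t c)
    base-column : ∀ q → clearedRow p (baseRow q) ≡ M (baseRow p) (baseRow q) + (+ 0 + (+ 0 + S (baseRow q)))
    base-column q = begin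
      clearedRow p (baseRow q)                                    ≡⟨ clearedRow-baseRow p q ⟩
      δℙ p q * a + (+ 1 + + parityCount m q) * w p q              ≡⟨ collect (δℙ p q) a (w p q) (+ parityCount m q) ⟩
      (δℙ p q * a + w p q) + (+ 0 + (+ 0 + + parityCount m q * w p q))
        ≡⟨ cong₂ (λ x s → x + (+ 0 + (+ 0 + s))) (trans (sym (P-baseRow p q)) (sym (base (baseRow q))))
                                                 (trans (sym (clearing-sum-baseRow p q)) (sym (S-reduced (baseRow q)))) ⟩
      M (baseRow p) (baseRow q) + (+ 0 + (+ 0 + S (baseRow q)))   ∎
      where collect : ∀ d a x c → d * a + (+ 1 + c) * x ≡ (d * a + x) + (+ 0 + (+ 0 + c * x))
            collect = solve-∀
    row-cleared : ∀ c → clearedRow p c ≡ M (baseRow p) c + sumFin n (λ k → clearing p k * M k c)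
    row-cleared fzero           = base-column 0ℙ
    row-cleared (fsuc fzero)    = base-column 1ℙ
    row-cleared (fsuc (fsuc s)) = sym (begin
      M (baseRow p) (fsuc (fsuc s)) + (+ 0 + (+ 0 + S (fsuc (fsuc s))))
        ≡⟨ cong₂ (λ x s → x + (+ 0 + (+ 0 + s)))
                 (trans (base (fsuc (fsuc s))) (cong₂ (λ d x → d * a + x) (identity-baseRow-suc² p s)
                                                       (cong (λ p → w p (parityOf s)) (parityOf-baseRow p))))
                 (trans (S-reduced (fsuc (fsuc s))) (clearing-sum-suc² p s)) ⟩
      + 0 * a + w p (parityOf s) + (+ 0 + (+ 0 + - w p (parityOf s)))
        ≡⟨ cancel a (w p (parityOf s)) ⟩
      + 0 ∎)
      where cancel : ∀ a x → + 0 * a + x + (+ 0 + (+ 0 + - x)) ≡ + 0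
            cancel = solve-∀

  cleared : Matrix n
  cleared = setRow (setRow reduced fzero (clearedRow 0ℙ)) (fsuc fzero) (clearedRow 1ℙ)

  det-cleared-block : det m (λ r c → cleared (fsuc (fsuc r)) (fsuc (fsuc c))) ≡ + 1
  det-cleared-block = trans (det-cong λ r c → trans (cong (_-_ (identity r c)) (identity-baseRow-suc² (parityOf r) c))
                                                    (ℤP.+-identityʳ (identity r c)))
                            (det-identity m)

  det-cleared : det n cleared ≡ det₂ Q
  det-cleared = begin
    + 1 * Q 0ℙ 0ℙ * det (suc m) (minor fzero cleared) +
      (- + 1 * Q 0ℙ 1ℙ * det (suc m) (minor (fsuc fzero) cleared) + sumFin m rest)
      ≡⟨ cong₂ (λ x y → + 1 * Q 0ℙ 0ℙ * x + (- + 1 * Q 0ℙ 1ℙ * y + sumFin m rest))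
               (trans (det-unit-row0 (minor fzero cleared) (λ _ → refl)) (cong (_*_ (Q 1ℙ 1ℙ)) det-cleared-block))
               (trans (det-unit-row0 (minor (fsuc fzero) cleared) (λ _ → refl)) (cong (_*_ (Q 1ℙ 0ℙ)) det-cleared-block)) ⟩
    + 1 * Q 0ℙ 0ℙ * (Q 1ℙ 1ℙ * + 1) + (- + 1 * Q 0ℙ 1ℙ * (Q 1ℙ 0ℙ * + 1) + sumFin m rest)
      ≡⟨ cong (λ z → + 1 * Q 0ℙ 0ℙ * (Q 1ℙ 1ℙ * + 1) + (- + 1 * Q 0ℙ 1ℙ * (Q 1ℙ 0ℙ * + 1) + z))
              (sumFin-zero rest λ j → cong (_* det (suc m) (minor (fsuc (fsuc j)) cleared))
                                            (ℤP.*-zeroʳ (sign (toℕ (fsuc (fsuc j)))))) ⟩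
    + 1 * Q 0ℙ 0ℙ * (Q 1ℙ 1ℙ * + 1) + (- + 1 * Q 0ℙ 1ℙ * (Q 1ℙ 0ℙ * + 1) + + 0)
      ≡⟨ expand (Q 0ℙ 0ℙ) (Q 0ℙ 1ℙ) (Q 1ℙ 0ℙ) (Q 1ℙ 1ℙ) ⟩
    det₂ Q ∎
    where
    rest : Fin m → ℤ
    rest j = sign (toℕ (fsuc (fsuc j))) * + 0 * det (suc m) (minor (fsuc (fsuc j)) cleared)
    expand : ∀ x y z t → + 1 * x * (t * + 1) + (- + 1 * y * (z * + 1) + + 0) ≡ x * t - y * z
    expand = solve-∀

  det-parityMatrix : det n P ≡ a ℤ.^ m * det₂ Q
  det-parityMatrix = begin
    det n P                   ≡⟨ det-parityMatrix-reduce ⟩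
    a ℤ.^ m * det n reduced   ≡⟨ cong (a ℤ.^ m *_) (det-clear-row 0ℙ reduced (λ _ _ → refl) (λ _ → refl)) ⟨
    a ℤ.^ m * det n half      ≡⟨ cong (a ℤ.^ m *_) (det-clear-row 1ℙ half (λ _ _ → refl) (λ _ → refl)) ⟨
    a ℤ.^ m * det n cleared   ≡⟨ cong (a ℤ.^ m *_) det-cleared ⟩
    a ℤ.^ m * det₂ Q          ∎
    where
    half : Matrix n
    half = setRow reduced fzero (clearedRow 0ℙ)

-- Polynomials in factored form

rootPoly : List ℤ → ℤ → ℤ
rootPoly L x = prodℤ (map (λ μ → x - μ) L)

rootPoly-↭ : ∀ {L L′} → L ↭ L′ → ∀ x → rootPoly L x ≡ rootPoly L′ x
rootPoly-↭ L↭L′ x = foldr-commMonoid (setoid ℤ) ℤP.*-1-isCommutativeMonoid (↭⇒↭ₛ (map⁺ (λ μ → x - μ) L↭L′))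

rootPoly≡0⇒∈ : ∀ L {x} → rootPoly L x ≡ + 0 → x ∈ L
rootPoly≡0⇒∈ (μ ∷ L) {x} P≡0 with ℤP.i*j≡0⇒i≡0∨j≡0 (x - μ) P≡0
... | inj₁ x-μ≡0 = here (ℤP.i-j≡0⇒i≡j x μ x-μ≡0)
... | inj₂ rest≡0 = there (rootPoly≡0⇒∈ L rest≡0)

rootPoly-root : ∀ μ L → rootPoly (μ ∷ L) μ ≡ + 0
rootPoly-root μ L = cong (_* rootPoly L μ) (ℤP.+-inverseʳ μ)

∈⇒↭∷ : ∀ {A : Set} {x : A} {L} → x ∈ L → ∃ λ L′ → L ↭ x ∷ L′
∈⇒↭∷ {L = _ ∷ L} (here refl) = L , ↭-refl
∈⇒↭∷ {L = μ ∷ _} (there x∈L) with ∈⇒↭∷ x∈L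
... | L′ , L↭x∷L′ = μ ∷ L′ , ↭-trans (prep μ L↭x∷L′) (swap μ _ ↭-refl)

rootPoly-shift : ∀ L x N → ∃ λ t → rootPoly L (x + N) ≡ rootPoly L x + N * t
rootPoly-shift []      x N = + 0 , sym (cong (_+_ (+ 1)) (ℤP.*-zeroʳ N))
rootPoly-shift (μ ∷ L) x N with rootPoly-shift L x N
... | t , shifted = rootPoly L x + N * t + (x - μ) * t ,
  trans (cong ((x + N - μ) *_) shifted) (expand x N μ (rootPoly L x) t)
  where expand : ∀ x N μ P t → (x + N - μ) * (P + N * t) ≡ (x - μ) * P + N * (P + N * t + (x - μ) * t)
        expand = solve-∀

suc-∣⇒≡0 : ∀ n → suc n ∣ n → n ≡ 0
suc-∣⇒≡0 zero    _       = refl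
suc-∣⇒≡0 (suc n) 1+n∣n   = contradiction 1+n∣n (>⇒∤ (ℕP.n<1+n (suc n)))

-- The difference d at x is divisible by N = 1 + |d|.
rootPoly-agree-at : ∀ L L′ x → (∀ y → y ≢ x → rootPoly L y ≡ rootPoly L′ y) → rootPoly L x ≡ rootPoly L′ x
rootPoly-agree-at L L′ x agree = ℤP.i-j≡0⇒i≡j _ _ (ℤP.∣i∣≡0⇒i≡0 (suc-∣⇒≡0 ℤ.∣ d ∣ N∣d))
  where
  d = rootPoly L x - rootPoly L′ x
  N = suc ℤ.∣ d ∣
  t t′ : ℤ
  t  = proj₁ (rootPoly-shift L x (+ N))
  t′ = proj₁ (rootPoly-shift L′ x (+ N))
  y≢x : x + + N ≢ x
  y≢x eq with trans (sym (cancel x (+ N))) (trans (cong (_- x) eq) (ℤP.+-inverseʳ x))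
    where cancel : ∀ x n → x + n - x ≡ n
          cancel = solve-∀
  ... | ()
  d≡k*N : d ≡ (t′ - t) * + N
  d≡k*N = begin
    d                                                                 ≡⟨ regroup (rootPoly L x) (rootPoly L′ x) (+ N) t t′ ⟨
    rootPoly L x + + N * t - (rootPoly L′ x + + N * t′) + (t′ - t) * + N
      ≡⟨ cong (λ z → z - (rootPoly L′ x + + N * t′) + (t′ - t) * + N)
              (trans (sym (proj₂ (rootPoly-shift L x (+ N)))) (trans (agree _ y≢x) (proj₂ (rootPoly-shift L′ x (+ N))))) ⟩
    rootPoly L′ x + + N * t′ - (rootPoly L′ x + + N * t′) + (t′ - t) * + N
      ≡⟨ cancel (rootPoly L′ x + + N * t′) ((t′ - t) * + N) ⟩
    (t′ - t) * + N                                                    ∎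
    where regroup : ∀ P P′ N t t′ → (P + N * t) - (P′ + N * t′) + (t′ - t) * N ≡ P - P′
          regroup = solve-∀
          cancel : ∀ a b → a - a + b ≡ b
          cancel = solve-∀
  N∣d : N ∣ ℤ.∣ d ∣
  N∣d = divides ℤ.∣ t′ - t ∣ (trans (cong ℤ.∣_∣ d≡k*N) (ℤP.abs-* (t′ - t) (+ N)))

rootPoly-injective : ∀ L L′ → (∀ x → rootPoly L x ≡ rootPoly L′ x) → L ↭ L′
rootPoly-injective []      []        _   = ↭-refl
rootPoly-injective (μ ∷ L) []        L≗L′ with trans (sym (rootPoly-root μ L)) (L≗L′ μ)
... | ()
rootPoly-injective L       (μ ∷ L′) L≗L′ with ∈⇒↭∷ (rootPoly≡0⇒∈ L (trans (L≗L′ μ) (rootPoly-root μ L′)))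
... | L₀ , L↭μ∷L₀ = ↭-trans L↭μ∷L₀ (prep μ (rootPoly-injective L₀ L′ L₀≗L′))
  where
  off-μ : ∀ y → y ≢ μ → rootPoly L₀ y ≡ rootPoly L′ y
  off-μ y y≢μ = ℤP.*-cancelˡ-≡ (y - μ) _ _ {{≢-nonZero (y≢μ ∘ ℤP.i-j≡0⇒i≡j y μ)}}
    (trans (sym (rootPoly-↭ L↭μ∷L₀ y)) (L≗L′ y))
  L₀≗L′ : ∀ y → rootPoly L₀ y ≡ rootPoly L′ y
  L₀≗L′ y with y ℤ.≟ μ
  ... | yes refl = rootPoly-agree-at L₀ L′ μ off-μ
  ... | no y≢μ   = off-μ y y≢μ

energy-↭ : ∀ {L L′} → L ↭ L′ → energy L ≡ energy L′
energy-↭ L↭L′ = sum-↭ (map⁺ ℤ.∣_∣ L↭L′)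

energy-unique : ∀ n D L L′ → HasSpectrum n D L → HasSpectrum n D L′ → energy L ≡ energy L′
energy-unique n D L L′ spec spec′ = energy-↭ (rootPoly-injective L L′ (λ x → trans (sym (spec x)) (spec′ x)))

-- The unitary Cayley graph on 2^k vertices

parity-∣-∣ : ∀ i j → parity ℕ.∣ i - j ∣ ≡ parity i ℙ.+ parity j
parity-∣-∣ zero    j       = refl
parity-∣-∣ (suc i) zero    = sym (ℙP.+-identityʳ (parity (suc i)))
parity-∣-∣ (suc i) (suc j) = begin
  parity ℕ.∣ i - j ∣                             ≡⟨ parity-∣-∣ i j ⟩
  parity i ℙ.+ parity j                          ≡⟨ flip-both (parity i) (parity j) ⟨
  (1ℙ ℙ.+ parity i) ℙ.+ (1ℙ ℙ.+ parity j)        ≡⟨ cong₂ ℙ._+_ (ℙP.+-homo-+ 1 i) (ℙP.+-homo-+ 1 j) ⟨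
  parity (suc i) ℙ.+ parity (suc j)              ∎
  where
  flip-both : ∀ p q → (1ℙ ℙ.+ p) ℙ.+ (1ℙ ℙ.+ q) ≡ p ℙ.+ q
  flip-both 0ℙ 0ℙ = refl
  flip-both 0ℙ 1ℙ = refl
  flip-both 1ℙ 0ℙ = refl
  flip-both 1ℙ 1ℙ = refl

p≢q⇒p+q≡1ℙ : ∀ p q → p ≢ q → p ℙ.+ q ≡ 1ℙ
p≢q⇒p+q≡1ℙ 0ℙ 0ℙ 0≢0 = contradiction refl 0≢0
p≢q⇒p+q≡1ℙ 0ℙ 1ℙ _   = refl
p≢q⇒p+q≡1ℙ 1ℙ 0ℙ _   = refl
p≢q⇒p+q≡1ℙ 1ℙ 1ℙ 1≢1 = contradiction refl 1≢1

2∣⇒parity≡0ℙ : ∀ {d} → 2 ∣ d → parity d ≡ 0ℙ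
2∣⇒parity≡0ℙ (divides q refl) = trans (ℙP.*-homo-* q 2) (ℙP.*-zeroʳ (parity q))

odd⇒coprime-2^ : ∀ {d} → parity d ≡ 1ℙ → ∀ k → Coprime d (2 ^ k)
odd⇒coprime-2^ odd zero    (_   , i∣1)   = ∣1⇒≡1 i∣1
odd⇒coprime-2^ odd (suc k) (i∣d , i∣2^k⁺) = odd⇒coprime-2^ odd k (i∣d , coprime-divisor coprime-2 i∣2^k⁺)
  where
  coprime-2 : Coprime _ 2
  coprime-2 {zero}              (_   , 0∣2) = contradiction (0∣⇒≡0 0∣2) λ ()
  coprime-2 {suc zero}          _           = refl
  coprime-2 {suc (suc zero)}    (2∣i , _)   = contradiction (trans (sym odd) (2∣⇒parity≡0ℙ (∣-trans 2∣i i∣d))) λ ()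
  coprime-2 {suc (suc (suc j))} (_   , j∣2) with ∣⇒≤ j∣2
  ... | s≤s (s≤s ())

even⇒gcd-2^≢1 : ∀ {d} → 2 ∣ d → ∀ k → gcd d (2 ^ suc k) ≢ 1
even⇒gcd-2^≢1 2∣d k gcd≡1 with ∣1⇒≡1 (subst (2 ∣_) gcd≡1 (gcd-greatest 2∣d (divides (2 ^ k) (ℕP.*-comm 2 (2 ^ k)))))
... | ()

parity≡0ℙ⇒2∣ : ∀ d → parity d ≡ 0ℙ → 2 ∣ d
parity≡0ℙ⇒2∣ zero          _    = divides 0 refl
parity≡0ℙ⇒2∣ (suc (suc d)) even with parity≡0ℙ⇒2∣ d even
... | divides q refl = divides (suc q) refl

parityDistance : ∀ {n} → Fin n → Fin n → ℕ
parityDistance a b = if does (a ≟ b) then 0 else if does (parityOf a ℙP.≟ parityOf b) then 2 else 1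

parityDistance≤2 : ∀ {n} (a b : Fin n) → parityDistance a b ≤ 2
parityDistance≤2 a b with does (a ≟ b) | does (parityOf a ℙP.≟ parityOf b)
... | true  | _     = z≤n
... | false | true  = ℕP.≤-refl
... | false | false = s≤s z≤n

parityDistance-same : ∀ {n} {a b : Fin n} → a ≢ b → parityOf a ≡ parityOf b → parityDistance a b ≡ 2
parityDistance-same {a = a} {b} a≢b pa≡pb =
  trans (cong (if_then 0 else (if does (parityOf a ℙP.≟ parityOf b) then 2 else 1)) (dec-false (a ≟ b) a≢b))
        (cong (if_then 2 else 1) (dec-true (parityOf a ℙP.≟ parityOf b) pa≡pb))

walk-0 : ∀ {n a b} → Walk n a b 0 → a ≡ b
walk-0 here = refl

walk-1 : ∀ {n a b} → Walk n a b 1 → Adj n a b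
walk-1 (step a~b here) = a~b

2≤2^suc : ∀ k → 2 ≤ 2 ^ suc k
2≤2^suc k = ℕP.*-monoʳ-≤ 2 (ℕP.m^n>0 2 k)

module _ (k : ℕ) where

  private
    n = 2 ^ suc k

    0<n : 0 < n
    0<n = ℕP.<-≤-trans (s≤s z≤n) (2≤2^suc k)

    1<n : 1 < n
    1<n = 2≤2^suc k

  parity≢⇒Adj : ∀ {a b : Fin n} → parityOf a ≢ parityOf b → Adj n a b
  parity≢⇒Adj {a} {b} pa≢pb =
    (pa≢pb ∘ cong parityOf) , coprime⇒gcd≡1 (odd⇒coprime-2^ {ℕ.∣ toℕ a - toℕ b ∣} odd (suc k))
    where
    odd : parity ℕ.∣ toℕ a - toℕ b ∣ ≡ 1ℙ
    odd = trans (parity-∣-∣ (toℕ a) (toℕ b)) (p≢q⇒p+q≡1ℙ _ _ pa≢pb)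

  Adj⇒parity≢ : ∀ {a b : Fin n} → Adj n a b → parityOf a ≢ parityOf b
  Adj⇒parity≢ {a} {b} (_ , gcd≡1) pa≡pb = even⇒gcd-2^≢1 (parity≡0ℙ⇒2∣ ℕ.∣ toℕ a - toℕ b ∣ even) k gcd≡1
    where
    even : parity ℕ.∣ toℕ a - toℕ b ∣ ≡ 0ℙ
    even = trans (parity-∣-∣ (toℕ a) (toℕ b)) (trans (cong (parityOf a ℙ.+_) (sym pa≡pb)) (ℙP.p+p≡0ℙ (parityOf a)))

  vertexOfParity : Parity → Fin n
  vertexOfParity 0ℙ = fromℕ< 0<n
  vertexOfParity 1ℙ = fromℕ< 1<n

  parityOf-vertexOfParity : ∀ p → parityOf (vertexOfParity p) ≡ p
  parityOf-vertexOfParity 0ℙ = cong parity (toℕ-fromℕ< 0<n)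
  parityOf-vertexOfParity 1ℙ = cong parity (toℕ-fromℕ< 1<n)

  -- Vertices of equal parity are not adjacent, but both are adjacent to any vertex of the other parity.
  parityDistance-isDist : ∀ a b → IsDist n a b (parityDistance a b)
  parityDistance-isDist a b with a ≟ b
  ... | yes refl = here , λ _ _ → z≤n
  ... | no a≢b with parityOf a ℙP.≟ parityOf b
  ...   | no pa≢pb  = step (parity≢⇒Adj pa≢pb) here , shortest
    where
    shortest : ∀ j → Walk n a b j → 1 ≤ j
    shortest zero    w = contradiction (walk-0 w) a≢b
    shortest (suc j) _ = s≤s z≤n
  ...   | yes pa≡pb = step (parity≢⇒Adj {a} {c} a≢c) (step (parity≢⇒Adj {c} {b} c≢b) here) , shortest
    where
    c : Fin n
    c = vertexOfParity (parityOf b ⁻¹)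
    c≢b : parityOf c ≢ parityOf b
    c≢b pc≡pb = ℙP.p≢p⁻¹ (parityOf b) (sym (trans (sym (parityOf-vertexOfParity _)) pc≡pb))
    a≢c : parityOf a ≢ parityOf c
    a≢c pa≡pc = c≢b (trans (sym pa≡pc) pa≡pb)
    shortest : ∀ j → Walk n a b j → 2 ≤ j
    shortest zero          w = contradiction (walk-0 w) a≢b
    shortest (suc zero)    w = contradiction pa≡pb (Adj⇒parity≢ (walk-1 w))
    shortest (suc (suc j)) _ = s≤s (s≤s z≤n)

parityDistance-diameter : ∀ k → HasDiameter (2 ^ suc (suc k)) 2
parityDistance-diameter k =
  (λ a b → parityDistance a b , parityDistance≤2 a b , parityDistance-isDist (suc k) a b) ,
  (v₀ , v₂ , subst (IsDist n v₀ v₂) (parityDistance-same v₀≢v₂ even) (parityDistance-isDist (suc k) v₀ v₂))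
  where
  n = 2 ^ suc (suc k)
  2<n : 2 < n
  2<n = ℕP.≤-trans (ℕP.n≤1+n 3) (ℕP.*-monoʳ-≤ 2 (2≤2^suc k))
  0<n : 0 < n
  0<n = ℕP.<-trans (s≤s z≤n) 2<n
  v₀ v₂ : Fin n
  v₀ = fromℕ< 0<n
  v₂ = fromℕ< 2<n
  even : parityOf v₀ ≡ parityOf v₂
  even = trans (cong parity (toℕ-fromℕ< 0<n)) (sym (cong parity (toℕ-fromℕ< 2<n)))
  v₀≢v₂ : v₀ ≢ v₂
  v₀≢v₂ v₀≡v₂ with trans (sym (toℕ-fromℕ< 0<n)) (trans (cong toℕ v₀≡v₂) (toℕ-fromℕ< 2<n))
  ... | ()

-- Spectrum and energy

distanceWeight : Parity → Parity → ℤ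
distanceWeight p q = if does (p ℙP.≟ q) then - + 2 else - + 1

charMatrix-parityDistance : ∀ {n} x (i j : Fin n) →
  (if does (i ≟ j) then x else + 0) - + parityDistance i j ≡ parityMatrix distanceWeight (x + + 2) i j
charMatrix-parityDistance x i j with i ≟ j
... | yes refl = trans (shift x) (cong (λ s → + 1 * (x + + 2) + (if s then - + 2 else - + 1))
                                    (sym (dec-true (parityOf i ℙP.≟ parityOf i) refl)))
  where shift : ∀ x → x - + 0 ≡ + 1 * (x + + 2) + - + 2
        shift = solve-∀
... | no _ with parityOf i ℙP.≟ parityOf j
...   | yes _ = refl
...   | no _  = refl

charPoly-parityDistance : ∀ m (D : Fin (suc (suc m)) → Fin (suc (suc m)) → ℕ) → (∀ a b → D a b ≡ parityDistance a b) →
  ∀ x → charPoly (suc (suc m)) D x ≡ (x + + 2) ℤ.^ m * det₂ (quotientMatrix distanceWeight (x + + 2) (suc (suc m)))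
charPoly-parityDistance m D D≗d x =
  trans (det-cong λ i j → trans (cong (λ d → (if does (i ≟ j) then x else + 0) - + d) (D≗d i j))
                                (charMatrix-parityDistance x i j))
        (det-parityMatrix distanceWeight (x + + 2) {m})

⌊2*n/2⌋≡n : ∀ n → ⌊ 2 ℕ.* n /2⌋ ≡ n
⌊2*n/2⌋≡n n = trans (cong (λ m → ⌊ n ℕ.+ m /2⌋) (ℕP.+-identityʳ n)) (sym (ℕP.n≡⌊n+n/2⌋ n))

⌈2*n/2⌉≡n : ∀ n → ⌈ 2 ℕ.* n /2⌉ ≡ n
⌈2*n/2⌉≡n n = ℕP.+-cancelˡ-≡ n _ _ (begin
  n ℕ.+ ⌈ 2 ℕ.* n /2⌉              ≡⟨ cong (ℕ._+ ⌈ 2 ℕ.* n /2⌉) (⌊2*n/2⌋≡n n) ⟨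
  ⌊ 2 ℕ.* n /2⌋ ℕ.+ ⌈ 2 ℕ.* n /2⌉  ≡⟨ ℕP.⌊n/2⌋+⌈n/2⌉≡n (2 ℕ.* n) ⟩
  2 ℕ.* n                          ≡⟨ cong (n ℕ.+_) (ℕP.+-identityʳ n) ⟩
  n ℕ.+ n                          ∎)

quotientMatrix-balanced : ∀ w a h p q → quotientMatrix w a (2 ℕ.* h) p q ≡ δℙ p q * a + + h * w p q
quotientMatrix-balanced w a h p 0ℙ = cong (λ c → δℙ p 0ℙ * a + + c * w p 0ℙ) (⌈2*n/2⌉≡n h)
quotientMatrix-balanced w a h p 1ℙ = cong (λ c → δℙ p 1ℙ * a + + c * w p 1ℙ) (⌊2*n/2⌋≡n h)

det₂-cong : ∀ {Q Q′} → (∀ p q → Q p q ≡ Q′ p q) → det₂ Q ≡ det₂ Q′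
det₂-cong Q≗Q′ =
  cong₂ _-_ (cong₂ _*_ (Q≗Q′ 0ℙ 0ℙ) (Q≗Q′ 1ℙ 1ℙ)) (cong₂ _*_ (Q≗Q′ 0ℙ 1ℙ) (Q≗Q′ 1ℙ 0ℙ))

unitarySpectrum : ℕ → ℕ → List ℤ
unitarySpectrum h m = (+ (3 ℕ.* h) - + 2) ∷ (+ h - + 2) ∷ replicate m (- (+ 2))

rootPoly-replicate : ∀ m v x → rootPoly (replicate m v) x ≡ (x - v) ℤ.^ m
rootPoly-replicate zero    v x = refl
rootPoly-replicate (suc m) v x = cong ((x - v) *_) (rootPoly-replicate m v x)

rootPoly-unitarySpectrum : ∀ h m x →
  rootPoly (unitarySpectrum h m) x ≡ (x + + 2) ℤ.^ m * det₂ (λ p q → δℙ p q * (x + + 2) + + h * distanceWeight p q)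
rootPoly-unitarySpectrum h m x = begin
  (x - (+ (3 ℕ.* h) - + 2)) * ((x - (+ h - + 2)) * rootPoly (replicate m (- + 2)) x)
    ≡⟨ cong₂ (λ t r → (x - (t - + 2)) * ((x - (+ h - + 2)) * r)) (ℤP.pos-* 3 h) (rootPoly-replicate m (- + 2) x) ⟩
  (x - (+ 3 * + h - + 2)) * ((x - (+ h - + 2)) * (x + + 2) ℤ.^ m)
    ≡⟨ factor x (+ h) ((x + + 2) ℤ.^ m) ⟩
  (x + + 2) ℤ.^ m * det₂ (λ p q → δℙ p q * (x + + 2) + + h * distanceWeight p q) ∎
  where
  factor : ∀ x h X → (x - (+ 3 * h - + 2)) * ((x - (h - + 2)) * X) ≡
    X * ((+ 1 * (x + + 2) + h * - + 2) * (+ 1 * (x + + 2) + h * - + 2) - (+ 0 * (x + + 2) + h * - + 1) * (+ 0 * (x + + 2) + h * - + 1))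
  factor = solve-∀

spectrum-balanced : ∀ h → 2 ≤ h → (D : Fin (2 ℕ.* h) → Fin (2 ℕ.* h) → ℕ) →
  (∀ a b → D a b ≡ parityDistance a b) →
  HasSpectrum (2 ℕ.* h) D (unitarySpectrum h (2 ℕ.* h ∸ 2))
spectrum-balanced h (s≤s (s≤s _)) D D≗d x = begin
  charPoly (2 ℕ.* h) D x
    ≡⟨ charPoly-parityDistance (2 ℕ.* h ∸ 2) D D≗d x ⟩
  (x + + 2) ℤ.^ (2 ℕ.* h ∸ 2) * det₂ (quotientMatrix distanceWeight (x + + 2) (2 ℕ.* h))
    ≡⟨ cong ((x + + 2) ℤ.^ (2 ℕ.* h ∸ 2) *_) (det₂-cong (quotientMatrix-balanced distanceWeight (x + + 2) h)) ⟩
  (x + + 2) ℤ.^ (2 ℕ.* h ∸ 2) * det₂ (λ p q → δℙ p q * (x + + 2) + + h * distanceWeight p q)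
    ≡⟨ rootPoly-unitarySpectrum h (2 ℕ.* h ∸ 2) x ⟨
  rootPoly (unitarySpectrum h (2 ℕ.* h ∸ 2)) x ∎

energy-replicate : ∀ m → energy (replicate m (- + 2)) ≡ 2 ℕ.* m
energy-replicate zero    = refl
energy-replicate (suc m) = trans (cong (2 ℕ.+_) (energy-replicate m)) (sym (ℕP.*-suc 2 m))

energy-unitarySpectrum : ∀ h → 2 ≤ h → energy (unitarySpectrum h (2 ℕ.* h ∸ 2)) ≡ 4 ℕ.* (2 ℕ.* h ∸ 2)
energy-unitarySpectrum (suc (suc n)) (s≤s (s≤s z≤n)) =
  trans (cong (λ e → n ℕ.+ 2 ℕ.* h ℕ.+ (n ℕ.+ e)) (energy-replicate (n ℕ.+ 1 ℕ.* h))) (arithmetic n)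
  where
  h = 2 ℕ.+ n
  -- |3h − 2| = n + 2h, |h − 2| = n and 2h − 2 = n + 1·h, written as Agda normalises them.
  arithmetic : ∀ n → n ℕ.+ 2 ℕ.* (2 ℕ.+ n) ℕ.+ (n ℕ.+ 2 ℕ.* (n ℕ.+ 1 ℕ.* (2 ℕ.+ n))) ≡
                     4 ℕ.* (n ℕ.+ 1 ℕ.* (2 ℕ.+ n))
  arithmetic = ℕ-Solver.solve-∀

IsDist-unique : ∀ {n a b m m′} → IsDist n a b m → IsDist n a b m′ → m ≡ m′
IsDist-unique (walk , shortest) (walk′ , shortest′) = ℕP.≤-antisym (shortest _ walk′) (shortest′ _ walk)

mainTheorem3 : (k : ℕ) → 1 < k →
    (D : Fin (2 ^ k) → Fin (2 ^ k) → ℕ) →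
    (∀ a b → IsDist (2 ^ k) a b (D a b)) →
    HasDiameter (2 ^ k) 2
    × HasSpectrum (2 ^ k) D
        ((+ (3 ℕ.* 2 ^ (k ∸ 1)) - + 2) ∷ (+ (2 ^ (k ∸ 1)) - + 2) ∷ replicate (2 ^ k ∸ 2) (- (+ 2)))
    × (∀ (L : List ℤ) → HasSpectrum (2 ^ k) D L → energy L ≡ 4 ℕ.* (2 ^ k ∸ 2))
mainTheorem3 (suc (suc k)) (s≤s (s≤s z≤n)) D D-isDist = parityDistance-diameter k , spectrum , energy-of
  where
  n h : ℕ
  n = 2 ^ suc (suc k)
  h = 2 ^ suc k
  D≗parityDistance : ∀ a b → D a b ≡ parityDistance a b
  D≗parityDistance a b = IsDist-unique (D-isDist a b) (parityDistance-isDist (suc k) a b)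
  spectrum : HasSpectrum n D (unitarySpectrum h (n ∸ 2))
  spectrum = spectrum-balanced h (2≤2^suc k) D D≗parityDistance
  energy-of : ∀ L → HasSpectrum n D L → energy L ≡ 4 ℕ.* (n ∸ 2)
  energy-of L spec-L =
    trans (energy-unique n D L (unitarySpectrum h (n ∸ 2)) spec-L spectrum) (energy-unitarySpectrum h (2≤2^suc k))
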